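{- Let $p\geq 5$ be a prime number and $n,k$ integers with $n\geq 1$ and $k\in\{0,1,\ldots,p-1\}$. Then \[ \binom{np^{2}-1}{k}_{3}\equiv \begin{cases} 1 \pmod{p^2} & \text{if } k\equiv 0 \pmod 4,\\ -1 \pmod{p^2} & \text{if } k\equiv 1 \pmod 4,\\ 0 \pmod{p^2} & \text{if } k\equiv 2 \pmod 4,\\ 0 \pmod{p^2} & \text{if } k\equiv 3 \pmod 4. \end{cases} \]
   Context: For a nonnegative integer $m$, the quadrinomial coefficients $\binom{m}{k}_{3}$ are defined by $(1+x+x^2+x^3)^{m}=\sum_{k=0}^{3m}\binom{m}{k}_{3}x^{k}$. -}

module Defs where

open import Data.Nat using (ℕ; zero; suc; _+_)

-- Quadrinomial coefficients: (1+x+x²+x³)^m = Σ_k quad m k · x^k.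
quad : ℕ → ℕ → ℕ
quad zero zero = 1
quad zero (suc k) = 0
quad (suc m) k = quad m k + sh1 k + sh2 k + sh3 k
  where
  sh1 : ℕ → ℕ
  sh1 zero = 0
  sh1 (suc k') = quad m k'
  sh2 : ℕ → ℕ
  sh2 (suc (suc k')) = quad m k'
  sh2 _ = 0
  sh3 : ℕ → ℕ
  sh3 (suc (suc (suc k'))) = quad m k'
  sh3 _ = 0

{-# OPTIONS --safe #-}
module Submission where

-- Write g = 1 + x + x² + x³ and N = n p².  Euler's identity x (g^N)′ = N g^(N-1) · x g′ compares
-- coefficients to k [x^k] g^N ≡ 0 (mod p²), so for 0 < k < p the coefficient [x^k] g^N is
-- divisible by p².  Hence g^(N-1) · g ≡ 1 (mod p², x^p), i.e. g^(N-1) agrees mod p² below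
-- degree p with 1/g = (1 - x)/(1 - x⁴) = 1 - x + x⁴ - x⁵ + ⋯.

open import Defs
open import Data.Nat as ℕ using (ℕ; zero; suc; _<_; _^_)
import Data.Nat.Properties as ℕ
open import Data.Nat.Divisibility as ℕ using (∣-trans)
open import Data.Nat.Coprimality using (Coprime; coprime-divisor; 1-coprimeTo; prime⇒coprime)
open import Data.Nat.Primality using (Prime; prime⇒nonZero)
open import Data.Product using (_×_; _,_; proj₁)
open import Relation.Binary.PropositionalEquality
  using (_≡_; refl; sym; cong; cong₂; subst; module ≡-Reasoning)

coprime-* : ∀ {a b n} → Coprime a n → Coprime b n → Coprime (a ℕ.* b) n
coprime-* {a} {b} {n} a⊥n b⊥n {d} (d∣ab , d∣n) = a⊥n (coprime-divisor d⊥b d∣ba , d∣n)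
  where
  d⊥b : Coprime d b
  d⊥b (e∣d , e∣b) = b⊥n (e∣b , ∣-trans e∣d d∣n)
  d∣ba : d ℕ.∣ b ℕ.* a
  d∣ba = subst (d ℕ.∣_) (ℕ.*-comm a b) d∣ab

coprime-^ : ∀ {m n} e → Coprime m n → Coprime (m ^ e) n
coprime-^ {n = n} zero    _   = 1-coprimeTo n
coprime-^         (suc e) m⊥n = coprime-* m⊥n (coprime-^ e m⊥n)

module Coefficients where
  open import Data.Nat.Divisibility using (_∣0)
  open import Data.Integer using (ℤ; +_; -[1+_]; -_; _+_; _-_; _*_)
  open import Data.Integer.Properties
    using (+-assoc; +-identityʳ; neg-distrib-+; *-zeroʳ; [1+m]⊖[1+n]≡m⊖n)
  import Data.Integer.Coprimality as ℤ
  open import Data.Integer.Divisibility using (_∣_)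
  open import Data.Integer.Divisibility.Signed
    using (∣ᵤ⇒∣; ∣⇒∣ᵤ; ∣m⇒∣m*n; ∣m∣n⇒∣m+n; ∣m∣n⇒∣m-n)
    renaming (_∣_ to _∣ˢ_)
  open import Data.Integer.Tactic.RingSolver using (solve-∀)
  open ≡-Reasoning

  -- Integer sequences are coefficient sequences of Laurent series; g = 1 + x + x² + x³.

  infixl 7 _·g _·xg′

  _·g : (ℤ → ℤ) → ℤ → ℤ
  (f ·g) i = f i + f (i - + 1) + f (i - + 2) + f (i - + 3)

  _·xg′ : (ℤ → ℤ) → ℤ → ℤ
  (f ·xg′) i = f (i - + 1) + + 2 * f (i - + 2) + + 3 * f (i - + 3)

  ·g-cong : ∀ {f h} → (∀ j → f j ≡ h j) → ∀ i → (f ·g) i ≡ (h ·g) i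
  ·g-cong f≗h i = cong₂ _+_ (cong₂ _+_ (cong₂ _+_ (f≗h i) (f≗h _)) (f≗h _)) (f≗h _)

  ·xg′-cong : ∀ {f h} → (∀ j → f j ≡ h j) → ∀ i → (f ·xg′) i ≡ (h ·xg′) i
  ·xg′-cong f≗h i =
    cong₂ _+_ (cong₂ _+_ (f≗h _) (cong (+ 2 *_) (f≗h _))) (cong (+ 3 *_) (f≗h _))

  ·g-scale : ∀ a f i → ((λ j → a * f j) ·g) i ≡ a * (f ·g) i
  ·g-scale a f i = identity a (f i) (f (i - + 1)) (f (i - + 2)) (f (i - + 3))
    where
    identity : ∀ a x y z w → a * x + a * y + a * z + a * w ≡ a * (x + y + z + w)
    identity = solve-∀

  ·g-sub : ∀ f h i → ((λ j → f j - h j) ·g) i ≡ (f ·g) i - (h ·g) i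
  ·g-sub f h i = identity (f i) (f (i - + 1)) (f (i - + 2)) (f (i - + 3))
                          (h i) (h (i - + 1)) (h (i - + 2)) (h (i - + 3))
    where
    identity : ∀ x y z w x′ y′ z′ w′ →
      (x - x′) + (y - y′) + (z - z′) + (w - w′) ≡ (x + y + z + w) - (x′ + y′ + z′ + w′)
    identity = solve-∀

  x∂ : (ℤ → ℤ) → ℤ → ℤ
  x∂ f i = i * f i

  x∂-·g : ∀ f i → x∂ (f ·g) i ≡ (x∂ f ·g) i + (f ·xg′) i
  x∂-·g f i = identity i (f i) (f (i - + 1)) (f (i - + 2)) (f (i - + 3))
    where
    identity : ∀ i x y z w → i * (x + y + z + w) ≡
      i * x + (i - + 1) * y + (i - + 2) * z + (i - + 3) * w + (y + + 2 * z + + 3 * w)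
    identity = solve-∀

  sub-sub : ∀ i a b → i - + a - + b ≡ i - + (a ℕ.+ b)
  sub-sub i a b = begin
    i - + a - + b         ≡⟨ +-assoc i (- + a) (- + b) ⟩
    i + (- + a + - + b)   ≡⟨ cong (λ j → i + j) (neg-distrib-+ (+ a) (+ b)) ⟨
    i - + (a ℕ.+ b)       ∎

  ·xg′-·g-comm : ∀ f i → (f ·g ·xg′) i ≡ (f ·xg′ ·g) i
  ·xg′-·g-comm f i
    rewrite sub-sub i 1 1 | sub-sub i 1 2 | sub-sub i 1 3
          | sub-sub i 2 1 | sub-sub i 2 2 | sub-sub i 2 3
          | sub-sub i 3 1 | sub-sub i 3 2 | sub-sub i 3 3
    = identity (f (i - + 1)) (f (i - + 2)) (f (i - + 3))
               (f (i - + 4)) (f (i - + 5)) (f (i - + 6))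
    where
    identity : ∀ x₁ x₂ x₃ x₄ x₅ x₆ →
      (x₁ + x₂ + x₃ + x₄) + + 2 * (x₂ + x₃ + x₄ + x₅) + + 3 * (x₃ + x₄ + x₅ + x₆) ≡
      (x₁ + + 2 * x₂ + + 3 * x₃) + (x₂ + + 2 * x₃ + + 3 * x₄)
        + (x₃ + + 2 * x₄ + + 3 * x₅) + (x₄ + + 2 * x₅ + + 3 * x₆)
    identity = solve-∀

  g^ : ℕ → ℤ → ℤ
  g^ m (+ k)    = + quad m k
  g^ m -[1+ _ ] = + 0

  g^-suc : ∀ m i → g^ (suc m) i ≡ (g^ m ·g) i
  g^-suc m -[1+ _ ]                = refl
  g^-suc m (+ 0)                   = refl
  g^-suc m (+ 1)                   = refl
  g^-suc m (+ 2)                   = refl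
  g^-suc m (+ suc (suc (suc _)))   = refl

  quad-0 : ∀ m → quad m 0 ≡ 1
  quad-0 zero    = refl
  quad-0 (suc m) = cong (ℕ._+ 0) (cong (ℕ._+ 0) (cong (ℕ._+ 0) (quad-0 m)))

  x∂-g^0 : ∀ j → x∂ (g^ 0) j ≡ + 0
  x∂-g^0 (+ 0)       = refl
  x∂-g^0 (+ suc k)   = *-zeroʳ (+ suc k)
  x∂-g^0 -[1+ n ]    = *-zeroʳ -[1+ n ]

  mutual
    x∂-g^ : ∀ m i → x∂ (g^ (suc m)) i ≡ + suc m * (g^ m ·xg′) i
    x∂-g^ m i = begin
      i * g^ (suc m) i                            ≡⟨ cong (i *_) (g^-suc m i) ⟩
      x∂ (g^ m ·g) i                              ≡⟨ x∂-·g (g^ m) i ⟩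
      (x∂ (g^ m) ·g) i + (g^ m ·xg′) i            ≡⟨ cong (_+ (g^ m ·xg′) i) (x∂-g^-·g m i) ⟩
      + m * (g^ m ·xg′) i + (g^ m ·xg′) i         ≡⟨ identity (+ m) ((g^ m ·xg′) i) ⟩
      + suc m * (g^ m ·xg′) i                     ∎
      where
      identity : ∀ a x → a * x + x ≡ (+ 1 + a) * x
      identity = solve-∀

    x∂-g^-·g : ∀ m i → (x∂ (g^ m) ·g) i ≡ + m * (g^ m ·xg′) i
    x∂-g^-·g zero    i = ·g-cong x∂-g^0 i
    x∂-g^-·g (suc m) i = begin
      (x∂ (g^ (suc m)) ·g) i                         ≡⟨ ·g-cong (x∂-g^ m) i ⟩
      ((λ j → + suc m * (g^ m ·xg′) j) ·g) i         ≡⟨ ·g-scale (+ suc m) (g^ m ·xg′) i ⟩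
      + suc m * (g^ m ·xg′ ·g) i                     ≡⟨ cong (+ suc m *_) (·xg′-·g-comm (g^ m) i) ⟨
      + suc m * (g^ m ·g ·xg′) i                     ≡⟨ cong (+ suc m *_) (·xg′-cong (g^-suc m) i) ⟨
      + suc m * (g^ (suc m) ·xg′) i                  ∎

  g^-coeff-divisible : ∀ {p m} → Prime p → p ^ 2 ℕ.∣ m →
                       ∀ k → suc k < p → + (p ^ 2) ∣ g^ m (+ suc k)
  g^-coeff-divisible {m = zero}  _     _      _ _   = _ ∣0
  g^-coeff-divisible {p} {suc m} p-prime p²∣1+m k k<p =
    ℤ.coprime-divisor (+ (p ^ 2)) (+ suc k) (g^ (suc m) (+ suc k)) p²⊥1+k (∣⇒∣ᵤ p²∣[1+k]*coeff)
    where
    p²⊥1+k : Coprime (p ^ 2) (suc k)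
    p²⊥1+k = coprime-^ 2 (prime⇒coprime p-prime k<p)
    p²∣[1+k]*coeff : + (p ^ 2) ∣ˢ + suc k * g^ (suc m) (+ suc k)
    p²∣[1+k]*coeff = subst (+ (p ^ 2) ∣ˢ_) (sym (x∂-g^ m (+ suc k)))
                           (∣m⇒∣m*n ((g^ m ·xg′) (+ suc k)) (∣ᵤ⇒∣ {i = + suc m} p²∣1+m))

  g⁻¹ : ℤ → ℤ
  g⁻¹ (+ 0)                         = + 1
  g⁻¹ (+ 1)                         = - + 1
  g⁻¹ (+ 2)                         = + 0
  g⁻¹ (+ 3)                         = + 0
  g⁻¹ (+ suc (suc (suc (suc k))))   = g⁻¹ (+ k)
  g⁻¹ -[1+ _ ]                      = + 0

  g⁻¹-mod4 : ∀ k → g⁻¹ (+ k) ≡ g⁻¹ (+ (k ℕ.% 4))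
  g⁻¹-mod4 0                           = refl
  g⁻¹-mod4 1                           = refl
  g⁻¹-mod4 2                           = refl
  g⁻¹-mod4 3                           = refl
  g⁻¹-mod4 (suc (suc (suc (suc k))))   = g⁻¹-mod4 k

  g⁻¹-window : ∀ k → g⁻¹ (+ (3 ℕ.+ k)) + g⁻¹ (+ (2 ℕ.+ k)) + g⁻¹ (+ (1 ℕ.+ k)) + g⁻¹ (+ k) ≡ + 0
  g⁻¹-window 0                           = refl
  g⁻¹-window 1                           = refl
  g⁻¹-window 2                           = refl
  g⁻¹-window 3                           = refl
  g⁻¹-window (suc (suc (suc (suc k))))   = g⁻¹-window k

  g⁻¹-·g : ∀ k → (g⁻¹ ·g) (+ suc k) ≡ + 0
  g⁻¹-·g 0                   = refl
  g⁻¹-·g 1                   = refl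
  g⁻¹-·g 2                   = refl
  g⁻¹-·g (suc (suc (suc k))) = g⁻¹-window (suc k)

  module _ {d : ℤ} {h : ℤ → ℤ} (h-neg : ∀ n → d ∣ˢ h -[1+ n ]) (h-0 : d ∣ˢ h (+ 0)) where

    ·g-at-suc : ∀ k → (h ·g) (+ suc k) ≡ h (+ suc k) + h (+ k) + h (+ k - + 1) + h (+ k - + 2)
    ·g-at-suc k = cong₂ (λ u v → h (+ suc k) + h (+ k) + h u + h v)
                        ([1+m]⊖[1+n]≡m⊖n k 1) ([1+m]⊖[1+n]≡m⊖n k 2)

    Window : ℕ → Set
    Window k = d ∣ˢ h (+ k) × d ∣ˢ h (+ k - + 1) × d ∣ˢ h (+ k - + 2)

    window : ∀ k → (∀ j → j < k → d ∣ˢ (h ·g) (+ suc j)) → Window k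
    window zero    _  = h-0 , h-neg 0 , h-neg 1
    window (suc k) ·g-divisible
      with h₀ , h₁ , h₂ ← window k (λ j j<k → ·g-divisible j (ℕ.m<n⇒m<1+n j<k))
      = subst (d ∣ˢ_) (sym (isolate _ _ _ _)) next
      , h₀
      , subst (λ i → d ∣ˢ h i) (sym ([1+m]⊖[1+n]≡m⊖n k 1)) h₁
      where
      isolate : ∀ x y z w → x ≡ (x + y + z + w) - (y + z + w)
      isolate = solve-∀
      next : d ∣ˢ (h (+ suc k) + h (+ k) + h (+ k - + 1) + h (+ k - + 2))
                  - (h (+ k) + h (+ k - + 1) + h (+ k - + 2))
      next = ∣m∣n⇒∣m-n (subst (d ∣ˢ_) (·g-at-suc k) (·g-divisible k (ℕ.n<1+n k)))
                       (∣m∣n⇒∣m+n (∣m∣n⇒∣m+n h₀ h₁) h₂)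

    ·g-divisible⇒divisible : ∀ k → (∀ j → j < k → d ∣ˢ (h ·g) (+ suc j)) → d ∣ˢ h (+ k)
    ·g-divisible⇒divisible k ·g-divisible = proj₁ (window k ·g-divisible)

  g^-≡-g⁻¹ : ∀ {p m} → Prime p → p ^ 2 ℕ.∣ suc m → ∀ k → k < p → + (p ^ 2) ∣ˢ g^ m (+ k) - g⁻¹ (+ k)
  g^-≡-g⁻¹ {p} {m} p-prime p²∣1+m k k<p =
    ·g-divisible⇒divisible {h = λ i → g^ m i - g⁻¹ i} (λ _ → ∣ᵤ⇒∣ (_ ∣0)) diff-0 k
      (λ j j<k → subst (_ ∣ˢ_) (sym (diff-·g j)) (∣ᵤ⇒∣ (g^-coeff-divisible p-prime p²∣1+m j
                                                           (ℕ.≤-<-trans j<k k<p))))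
    where
    diff-0 : + (p ^ 2) ∣ˢ g^ m (+ 0) - + 1
    diff-0 = subst (λ c → + (p ^ 2) ∣ˢ + c - + 1) (sym (quad-0 m)) (∣ᵤ⇒∣ (_ ∣0))
    diff-·g : ∀ j → ((λ i → g^ m i - g⁻¹ i) ·g) (+ suc j) ≡ g^ (suc m) (+ suc j)
    diff-·g j = begin
      ((λ i → g^ m i - g⁻¹ i) ·g) (+ suc j)             ≡⟨ ·g-sub (g^ m) g⁻¹ (+ suc j) ⟩
      (g^ m ·g) (+ suc j) - (g⁻¹ ·g) (+ suc j)          ≡⟨ cong₂ _-_ (sym (g^-suc m (+ suc j))) (g⁻¹-·g j) ⟩
      g^ (suc m) (+ suc j) - + 0                         ≡⟨ +-identityʳ _ ⟩
      g^ (suc m) (+ suc j)                               ∎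

open Coefficients using (g⁻¹; g⁻¹-mod4; g^-≡-g⁻¹)
open import Data.Nat using (_≥_; _*_; _∸_; _%_)
open import Data.Nat.Divisibility using (n∣m*n)
open import Data.Integer using (+_; -_; _-_)
open import Data.Integer.Properties using (+-identityʳ)
open import Data.Integer.Divisibility using (_∣_)
open import Data.Integer.Divisibility.Signed using (∣⇒∣ᵤ)

corollaryC : (p n k : ℕ) → Prime p → p ≥ 5 → n ≥ 1 → k < p →
    (k % 4 ≡ 0 → (+ (p ^ 2)) ∣ ((+ quad (n * p ^ 2 ∸ 1) k) - (+ 1))) ×
    (k % 4 ≡ 1 → (+ (p ^ 2)) ∣ ((+ quad (n * p ^ 2 ∸ 1) k) - (- (+ 1)))) ×
    (k % 4 ≡ 2 → (+ (p ^ 2)) ∣ (+ quad (n * p ^ 2 ∸ 1) k)) ×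
    (k % 4 ≡ 3 → (+ (p ^ 2)) ∣ (+ quad (n * p ^ 2 ∸ 1) k))
corollaryC p n k p-prime _ n≥1 k<p =
  congruent 0 , congruent 1 ,
  (λ k≡2 → subst (+ (p ^ 2) ∣_) (+-identityʳ (+ quad (n * p ^ 2 ∸ 1) k)) (congruent 2 k≡2)) ,
  (λ k≡3 → subst (+ (p ^ 2) ∣_) (+-identityʳ (+ quad (n * p ^ 2 ∸ 1) k)) (congruent 3 k≡3))
  where
  instance _ = prime⇒nonZero p-prime
  1+M≡np² : suc (n * p ^ 2 ∸ 1) ≡ n * p ^ 2
  1+M≡np² = ℕ.m+[n∸m]≡n (ℕ.*-mono-≤ n≥1 (ℕ.m^n>0 p 2))
  congruent : ∀ r → k % 4 ≡ r → + (p ^ 2) ∣ + quad (n * p ^ 2 ∸ 1) k - g⁻¹ (+ r)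
  congruent _ refl = subst (λ c → + (p ^ 2) ∣ + quad (n * p ^ 2 ∸ 1) k - c) (g⁻¹-mod4 k)
    (∣⇒∣ᵤ (g^-≡-g⁻¹ p-prime (subst (p ^ 2 ℕ.∣_) (sym 1+M≡np²) (n∣m*n n)) k k<p))
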